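{- Let $G$ be a finite simple graph and let $P$ be a solvable pebble distribution on $G$. Then $$\sum_{v\in V(G)}\mathrm{ef}(v)\,P(v)\;\geq\;|V(G)|+\mathrm{TE}(P).$$
   Context: A pebble distribution $P$ on $G$ is a function $V(G)\to\mathbb{Z}_{\geq 0}$; $|P|=\sum_v P(v)$. A pebbling move from a vertex $u$ with at least two pebbles to a neighbor $v$ removes two pebbles from $u$ and adds one pebble to $v$. A vertex $v$ is $k$-reachable under $P$ if some sequence of pebbling moves (each keeping all pebble counts nonnegative) yields a distribution with at least $k$ pebbles on $v$; reachable means $1$-reachable. $P$ is solvable if every vertex is reachable. $\mathrm{reach}(P,v)$ is the largest $k$ such that $v$ is $k$-reachable under $P$; the excess $\mathrm{exc}(P,v)$ is $\mathrm{reach}(P,v)-1$ if $v$ is reachable and $0$ otherwise; the total excess is $\mathrm{TE}(P)=\sum_{v\in V(G)}\mathrm{exc}(P,v)$. For a vertex $v$, $N_i(v)$ is the set of vertices at distance exactly $i$ from $v$, and the effect of $v$ is $\mathrm{ef}(v)=\sum_{i\geq 0}(1/2)^i|N_i(v)|$. -}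

module Defs where

open import Data.Nat using (ℕ; zero; suc; _+_; _∸_; _≤_)
open import Data.Fin using (Fin; zero; suc; _≟_)
open import Data.Bool using (Bool; true; false; _∧_; _∨_; not; if_then_else_)
open import Data.Product using (Σ; _×_; ∃-syntax)
open import Data.List using (List; map; foldr)
open import Data.List.Base using (allFin)
open import Data.Bool.ListAction using (any)
open import Data.Integer using (+_)
open import Relation.Nullary using (¬_)
open import Relation.Nullary.Decidable using (⌊_⌋)
open import Relation.Binary.PropositionalEquality using (_≡_)
import Data.Rational as Q
open Q using (ℚ)

record Graph : Set where
  field
    n     : ℕ
    adj   : Fin n → Fin n → Bool
    sym   : ∀ u v → adj u v ≡ adj v u
    irrefl : ∀ v → adj v v ≡ false
open Graph public

Dist : Graph → Set
Dist G = Fin (n G) → ℕ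

Σℕ : ∀ {m} → (Fin m → ℕ) → ℕ
Σℕ {m} f = foldr _+_ 0 (map f (allFin m))

Σℚ : ∀ {m} → (Fin m → ℚ) → ℚ
Σℚ {m} f = foldr Q._+_ Q.0ℚ (map f (allFin m))

size : (G : Graph) → Dist G → ℕ
size G P = Σℕ P

move : (G : Graph) → Dist G → Fin (n G) → Fin (n G) → Dist G
move G P u v w =
  (if ⌊ w ≟ u ⌋ then P w ∸ 2 else P w) + (if ⌊ w ≟ v ⌋ then 1 else 0)

data Moves (G : Graph) : Dist G → Dist G → Set where
  done : ∀ {P} → Moves G P P
  step : ∀ {P Q} (u v : Fin (n G)) → adj G u v ≡ true → 2 ≤ P u →
         Moves G (move G P u v) Q → Moves G P Q

KReachable : (G : Graph) → Dist G → ℕ → Fin (n G) → Set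
KReachable G P k v = ∃[ Q ] (Moves G P Q × k ≤ Q v)

Reachable : (G : Graph) → Dist G → Fin (n G) → Set
Reachable G P v = KReachable G P 1 v

Solvable : (G : Graph) → Dist G → Set
Solvable G P = ∀ v → Reachable G P v

IsReach : (G : Graph) → Dist G → (Fin (n G) → ℕ) → Set
IsReach G P r = ∀ v → KReachable G P (r v) v × ¬ KReachable G P (suc (r v)) v

-- excess from reach: reach - 1 if reachable (reach ≥ 1), else 0 (reach = 0)
excess : ℕ → ℕ
excess k = k ∸ 1

TE : (G : Graph) → (Fin (n G) → ℕ) → ℕ
TE G r = Σℕ (λ v → excess (r v))

-- ball G v k w : dist(v,w) ≤ k
ball : (G : Graph) → Fin (n G) → ℕ → Fin (n G) → Bool
ball G v zero w = ⌊ v ≟ w ⌋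
ball G v (suc k) w = ball G v k w ∨ any (λ u → ball G v k u ∧ adj G u w) (allFin (n G))

-- atDist G v i w : dist(v,w) = i exactly, i.e. w ∈ N_i(v)
atDist : (G : Graph) → Fin (n G) → ℕ → Fin (n G) → Bool
atDist G v zero w = ball G v zero w
atDist G v (suc i) w = ball G v (suc i) w ∧ not (ball G v i w)

Nsize : (G : Graph) → Fin (n G) → ℕ → ℕ
Nsize G v i = Σℕ (λ w → if atDist G v i w then 1 else 0)

toℚ : ℕ → ℚ
toℚ m = (+ m) Q./ 1

halfPow : ℕ → ℚ
halfPow zero = Q.1ℚ
halfPow (suc i) = Q.½ Q.* halfPow i

Σupto : ℕ → (ℕ → ℚ) → ℚ
Σupto zero f = f zero
Σupto (suc m) f = Σupto m f Q.+ f (suc m)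

-- effect ef(v) = Σ_i (1/2)^i |N_i(v)|; distances in a graph on n vertices are ≤ n,
-- so summing i = 0..n covers every nonempty N_i(v).
ef : (G : Graph) → Fin (n G) → ℚ
ef G v = Σupto (n G) (λ i → halfPow i Q.* toℚ (Nsize G v i))

module Submission where

-- Fix a target w and weigh every vertex x by c(x) = 2^(n - dist(x, w)), or 0 if w cannot be
-- reached from x. A move from u to an adjacent v takes two pebbles of weight c(u) and creates
-- one of weight c(v) ≤ 2 c(u), so the weighted pebble count never grows; as w itself has weight 2^n,
-- putting k pebbles on w needs weighted count at least 2^n k. Summing over w, with
-- reach(P, w) ≥ 1 by solvability, gives 2^n (n + TE(P)) ≤ Σ_x (Σ_w 2^(n - dist(x, w))) P(x),
-- and the inner sum is 2^n ef(x).

open import Defs hiding (sym)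

module EffectBound where

  open import Algebra.Bundles using (CommutativeMonoid; Ring)
  import Algebra.Properties.CommutativeSemigroup as CommutativeSemigroupProperties
  import Algebra.Properties.Semiring.Sum as SemiringSum
  open import Data.Bool using (Bool; true; false; if_then_else_; T; _∧_; _∨_; not)
  open import Data.Bool.ListAction using (or)
  import Data.Bool.Properties as Bool
  open import Data.Empty using (⊥-elim)
  open import Data.Fin using (Fin; zero; suc; _≟_)
  open import Data.Fin.Properties using (nonZeroIndex)
  import Data.Integer as ℤ
  import Data.Integer.Properties as ℤₚ
  open import Data.List using (foldr; map; tabulate; allFin)
  open import Data.List.Membership.Propositional using (lose)
  open import Data.List.Membership.Propositional.Properties using (∈-allFin)
  open import Data.List.Properties using (map-tabulate; map-cong)
  open import Data.List.Relation.Unary.Any using (satisfied)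
  open import Data.List.Relation.Unary.Any.Properties using (any⁺; any⁻)
  open import Data.Nat hiding (_≟_)
  open import Data.Nat.Properties renaming (_≟_ to _≟ℕ_)
  open import Data.Product using (_,_; proj₁; proj₂)
  import Data.Rational as ℚ
  import Data.Rational.Properties as ℚₚ
  open import Data.Rational.Solver using (module +-*-Solver)
  import Data.Rational.Unnormalised as ℚᵘ
  import Data.Rational.Unnormalised.Properties as ℚᵘₚ
  open import Data.Sum using (inj₁; inj₂)
  import Data.Vec.Functional as Vector
  open import Function using (id; _∘_; Equivalence)
  open import Relation.Binary.PropositionalEquality
  open import Relation.Nullary using (¬_; Dec; yes; no; contradiction)
  open import Relation.Nullary.Decidable using (⌊_⌋; fromWitness; toWitness)

  open SemiringSum +-*-semiring
    using (sum; sum-syntax; sum-cong-≗; ∑-distrib-+; ∑-comm; *-distribˡ-sum; *-distribʳ-sum)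
  module ℚΣ = SemiringSum (Ring.semiring ℚₚ.+-*-ring)
  module ℕ* = CommutativeSemigroupProperties *-commutativeSemigroup
  module ℚ* = CommutativeSemigroupProperties (CommutativeMonoid.commutativeSemigroup ℚₚ.*-1-commutativeMonoid)

  foldr-map-allFin : ∀ {A B : Set} (c : A → B → B) (e : B) {m} (f : Fin m → A) →
                     foldr c e (map f (allFin m)) ≡ Vector.foldr c e f
  foldr-map-allFin {A} c e {m} f = trans (cong (foldr c e) (map-tabulate id f)) (foldr-tabulate f)
    where
    foldr-tabulate : ∀ {k} (g : Fin k → A) → foldr c e (tabulate g) ≡ Vector.foldr c e g
    foldr-tabulate {zero} g = refl
    foldr-tabulate {suc k} g = cong (c (g zero)) (foldr-tabulate (g ∘ suc))

  Σℕ≡sum : ∀ {m} (f : Fin m → ℕ) → Σℕ f ≡ sum f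
  Σℕ≡sum = foldr-map-allFin _+_ 0

  Σℚ≡sum : ∀ {m} (f : Fin m → ℚ.ℚ) → Σℚ f ≡ ℚΣ.sum f
  Σℚ≡sum = foldr-map-allFin ℚ._+_ ℚ.0ℚ

  ∑-1 : ∀ m → ∑[ i < m ] 1 ≡ m
  ∑-1 zero = refl
  ∑-1 (suc m) = cong suc (∑-1 m)

  sum-mono-≤ : ∀ {m} {f g : Fin m → ℕ} → (∀ i → f i ≤ g i) → sum f ≤ sum g
  sum-mono-≤ {zero} f≤g = z≤n
  sum-mono-≤ {suc m} f≤g = +-mono-≤ (f≤g zero) (sum-mono-≤ (f≤g ∘ suc))

  sum-mono-< : ∀ {m} {f g : Fin m → ℕ} → (∀ i → f i ≤ g i) → ∀ j → f j < g j → sum f < sum g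
  sum-mono-< f≤g zero fj<gj = +-mono-<-≤ fj<gj (sum-mono-≤ (f≤g ∘ suc))
  sum-mono-< f≤g (suc j) fj<gj = +-mono-≤-< (f≤g zero) (sum-mono-< (f≤g ∘ suc) j fj<gj)

  sum-≡⇒≗ : ∀ {m} {f g : Fin m → ℕ} → (∀ i → f i ≤ g i) → sum f ≡ sum g → f ≗ g
  sum-≡⇒≗ {f = f} {g} f≤g Σf≡Σg i with f i ≟ℕ g i
  ... | yes fi≡gi = fi≡gi
  ... | no fi≢gi = contradiction Σf≡Σg (<⇒≢ (sum-mono-< f≤g i (≤∧≢⇒< (f≤g i) fi≢gi)))

  ≤-sum : ∀ {m} (f : Fin m → ℕ) i → f i ≤ sum f
  ≤-sum f zero = m≤m+n _ _
  ≤-sum f (suc i) = ≤-trans (≤-sum (f ∘ suc) i) (m≤n+m _ (f zero))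

  indicator : Bool → ℕ
  indicator b = if b then 1 else 0

  indicator-mono : ∀ {a b} → (T a → T b) → indicator a ≤ indicator b
  indicator-mono {false} a⇒b = z≤n
  indicator-mono {true} {true} a⇒b = ≤-refl
  indicator-mono {true} {false} a⇒b = ⊥-elim (a⇒b _)

  indicator-false : ∀ {b} → ¬ T b → indicator b ≡ 0
  indicator-false {false} _ = refl
  indicator-false {true} ¬tt = ⊥-elim (¬tt _)

  indicator-true : ∀ {b} → T b → indicator b ≡ 1
  indicator-true {true} _ = refl

  indicator-∧-monoˡ : ∀ {a b} c → (T a → T b) → indicator (a ∧ c) ≤ indicator (b ∧ c)
  indicator-∧-monoˡ c a⇒b = indicator-mono (λ a∧c →
    let (ta , tc) = Equivalence.to Bool.T-∧ a∧c in Equivalence.from Bool.T-∧ (a⇒b ta , tc))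

  indicator-∧-not : ∀ {a} b → (T b → T a) → indicator (b ∧ not a) ≡ 0
  indicator-∧-not false _ = refl
  indicator-∧-not {true} true _ = refl
  indicator-∧-not {false} true b⇒a = ⊥-elim (b⇒a _)

  indicator-injective : ∀ {a b} → indicator a ≡ indicator b → a ≡ b
  indicator-injective {false} {false} _ = refl
  indicator-injective {true} {true} _ = refl

  indicator-≤-split : ∀ a c → indicator a ≤ indicator c + indicator (a ∧ not c)
  indicator-≤-split false c = z≤n
  indicator-≤-split true false = ≤-refl
  indicator-≤-split true true = ≤-refl

  δ : ∀ {m} → Fin m → Fin m → ℕ
  δ u x = indicator ⌊ x ≟ u ⌋

  δ-suc : ∀ {m} (u x : Fin m) → δ (suc u) (suc x) ≡ δ u x
  δ-suc u x with x ≟ u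
  ... | yes _ = refl
  ... | no _ = refl

  ∑-*-δ : ∀ {m} (f : Fin m → ℕ) u → ∑[ x < m ] (f x * δ u x) ≡ f u
  ∑-*-δ {suc m} f zero = begin
    f zero * 1 + ∑[ x < m ] (f (suc x) * 0) ≡⟨ cong₂ _+_ (*-identityʳ (f zero)) (sym (*-distribʳ-sum 0 (f ∘ suc))) ⟩
    f zero + sum (f ∘ suc) * 0             ≡⟨ cong (f zero +_) (*-zeroʳ (sum (f ∘ suc))) ⟩
    f zero + 0                             ≡⟨ +-identityʳ (f zero) ⟩
    f zero                                 ∎
    where open ≡-Reasoning
  ∑-*-δ {suc m} f (suc u) =
    cong₂ _+_ (*-zeroʳ (f zero)) (trans (sum-cong-≗ (λ x → cong (f (suc x) *_) (δ-suc u x))) (∑-*-δ (f ∘ suc) u))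

  module GrowingChain {m : ℕ} (b : ℕ → Fin m → Bool)
    (grows : ∀ k x → T (b k x) → T (b (suc k) x))
    (persists : ∀ k → b (suc k) ≗ b k → b (suc (suc k)) ≗ b (suc k))
    where

    Stable : ℕ → Set
    Stable k = b (suc k) ≗ b k

    count : ℕ → ℕ
    count k = ∑[ x < m ] indicator (b k x)

    count≤size : ∀ k → count k ≤ m
    count≤size k = ≤-trans (sum-mono-≤ (λ x → indicator-mono {b k x} {true} _)) (≤-reflexive (∑-1 m))

    stable-forever : ∀ {k} → Stable k → ∀ j → Stable (j + k)
    stable-forever stable zero = stable
    stable-forever stable (suc j) = persists _ (stable-forever stable j)

    count-grows : ∀ {k} → ¬ Stable k → count k < count (suc k)
    count-grows {k} unstable = ≤∧≢⇒< (sum-mono-≤ bₖ⊆bₖ₊₁) equal-counts⇒stable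
      where
      bₖ⊆bₖ₊₁ : ∀ x → indicator (b k x) ≤ indicator (b (suc k) x)
      bₖ⊆bₖ₊₁ x = indicator-mono (grows k x)
      equal-counts⇒stable : count k ≢ count (suc k)
      equal-counts⇒stable eq = unstable (λ x → sym (indicator-injective (sum-≡⇒≗ bₖ⊆bₖ₊₁ eq x)))

    count-lower-bound : ∀ {M} → ¬ Stable M → ∀ k → k ≤ suc M → k + count 0 ≤ count k
    count-lower-bound unstable zero _ = ≤-refl
    count-lower-bound {M} unstable (suc k) (s≤s k≤M) =
      ≤-trans (s≤s (count-lower-bound unstable k (m≤n⇒m≤1+n k≤M))) (count-grows unstableₖ)
      where
      unstableₖ : ¬ Stable k
      unstableₖ stable = unstable (subst Stable (m∸n+n≡m k≤M) (stable-forever stable (M ∸ k)))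

    -- Each unstable step adds an element, so a chain still growing at step pred m would give
    -- b m more than m elements.
    stabilises : ∀ x → T (b 0 x) → Stable (pred m)
    stabilises x b₀x y with b (suc (pred m)) y Bool.≟ b (pred m) y
    ... | yes eq = eq
    ... | no neq = contradiction (count-lower-bound (λ stable → neq (stable y)) m′ ≤-refl) (<⇒≱ too-many)
      where
      m′ : ℕ
      m′ = suc (pred m)
      too-many : count m′ < m′ + count 0
      too-many = begin-strict
        count m′      ≤⟨ count≤size m′ ⟩
        m             ≡⟨ suc-pred m {{nonZeroIndex x}} ⟨
        m′            <⟨ m<m+n m′ (≤-trans (indicator-mono {true} (λ _ → b₀x)) (≤-sum (λ y → indicator (b 0 y)) x)) ⟩
        m′ + count 0  ∎
        where open ≤-Reasoning

  -- horner₂ a m = Σ_{i ≤ m} 2^(m ∸ i) * a i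
  horner₂ : (ℕ → ℕ) → ℕ → ℕ
  horner₂ a zero = a zero
  horner₂ a (suc m) = 2 * horner₂ a m + a (suc m)

  horner₂-cong : ∀ {a b : ℕ → ℕ} → (∀ i → a i ≡ b i) → ∀ m → horner₂ a m ≡ horner₂ b m
  horner₂-cong a≗b zero = a≗b zero
  horner₂-cong a≗b (suc m) = cong₂ _+_ (cong (2 *_) (horner₂-cong a≗b m)) (a≗b (suc m))

  ∑-horner₂ : ∀ {k} (f : Fin k → ℕ → ℕ) m →
              ∑[ x < k ] horner₂ (f x) m ≡ horner₂ (λ i → ∑[ x < k ] f x i) m
  ∑-horner₂ f zero = refl
  ∑-horner₂ {k} f (suc m) = begin
    ∑[ x < k ] (2 * horner₂ (f x) m + f x (suc m))
      ≡⟨ ∑-distrib-+ (λ x → 2 * horner₂ (f x) m) (λ x → f x (suc m)) ⟩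
    ∑[ x < k ] (2 * horner₂ (f x) m) + ∑[ x < k ] f x (suc m)
      ≡⟨ cong (_+ ∑[ x < k ] f x (suc m)) (*-distribˡ-sum 2 (λ x → horner₂ (f x) m)) ⟨
    2 * ∑[ x < k ] horner₂ (f x) m + ∑[ x < k ] f x (suc m)
      ≡⟨ cong (λ h → 2 * h + ∑[ x < k ] f x (suc m)) (∑-horner₂ f m) ⟩
    2 * horner₂ (λ i → ∑[ x < k ] f x i) m + ∑[ x < k ] f x (suc m) ∎
    where open ≡-Reasoning

  2^m*a₀≤horner₂ : ∀ a m → 2 ^ m * a 0 ≤ horner₂ a m
  2^m*a₀≤horner₂ a zero = ≤-reflexive (+-identityʳ (a 0))
  2^m*a₀≤horner₂ a (suc m) = begin
    2 * 2 ^ m * a 0            ≡⟨ *-assoc 2 (2 ^ m) (a 0) ⟩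
    2 * (2 ^ m * a 0)          ≤⟨ *-monoʳ-≤ 2 (2^m*a₀≤horner₂ a m) ⟩
    2 * horner₂ a m            ≤⟨ m≤m+n _ _ ⟩
    horner₂ a (suc m)          ∎
    where open ≤-Reasoning

  toℚᵘ-toℚ : ∀ m → ℚ.toℚᵘ (toℚ m) ℚᵘ.≃ ℚᵘ.mkℚᵘ (ℤ.+ m) 0
  toℚᵘ-toℚ m = ℚₚ.toℚᵘ-fromℚᵘ (ℚᵘ.mkℚᵘ (ℤ.+ m) 0)

  toℚ-+ : ∀ a b → toℚ (a + b) ≡ toℚ a ℚ.+ toℚ b
  toℚ-+ a b = ℚₚ.toℚᵘ-injective (begin
    ℚ.toℚᵘ (toℚ (a + b))                      ≈⟨ toℚᵘ-toℚ (a + b) ⟩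
    ℚᵘ.mkℚᵘ (ℤ.+ (a + b)) 0                   ≈⟨ ℚᵘ.*≡* numerators-agree ⟩
    ℚᵘ.mkℚᵘ (ℤ.+ a) 0 ℚᵘ.+ ℚᵘ.mkℚᵘ (ℤ.+ b) 0  ≈⟨ ℚᵘₚ.+-cong (toℚᵘ-toℚ a) (toℚᵘ-toℚ b) ⟨
    ℚ.toℚᵘ (toℚ a) ℚᵘ.+ ℚ.toℚᵘ (toℚ b)        ≈⟨ ℚₚ.toℚᵘ-homo-+ (toℚ a) (toℚ b) ⟨
    ℚ.toℚᵘ (toℚ a ℚ.+ toℚ b)                  ∎)
    where
    open ℚᵘₚ.≃-Reasoning
    numerators-agree : ℤ.+ (a + b) ℤ.* ℤ.1ℤ ≡ (ℤ.+ a ℤ.* ℤ.1ℤ ℤ.+ ℤ.+ b ℤ.* ℤ.1ℤ) ℤ.* ℤ.1ℤ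
    numerators-agree = trans (ℤₚ.*-identityʳ _) (trans (ℤₚ.pos-+ a b) (sym (trans (ℤₚ.*-identityʳ _)
      (cong₂ ℤ._+_ (ℤₚ.*-identityʳ (ℤ.+ a)) (ℤₚ.*-identityʳ (ℤ.+ b))))))

  toℚ-* : ∀ a b → toℚ (a * b) ≡ toℚ a ℚ.* toℚ b
  toℚ-* a b = ℚₚ.toℚᵘ-injective (begin
    ℚ.toℚᵘ (toℚ (a * b))                      ≈⟨ toℚᵘ-toℚ (a * b) ⟩
    ℚᵘ.mkℚᵘ (ℤ.+ (a * b)) 0                   ≈⟨ ℚᵘ.*≡* (cong (ℤ._* ℤ.1ℤ) (ℤₚ.pos-* a b)) ⟩
    ℚᵘ.mkℚᵘ (ℤ.+ a) 0 ℚᵘ.* ℚᵘ.mkℚᵘ (ℤ.+ b) 0  ≈⟨ ℚᵘₚ.*-cong (toℚᵘ-toℚ a) (toℚᵘ-toℚ b) ⟨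
    ℚ.toℚᵘ (toℚ a) ℚᵘ.* ℚ.toℚᵘ (toℚ b)        ≈⟨ ℚₚ.toℚᵘ-homo-* (toℚ a) (toℚ b) ⟨
    ℚ.toℚᵘ (toℚ a ℚ.* toℚ b)                  ∎)
    where open ℚᵘₚ.≃-Reasoning

  toℚ-mono-≤ : ∀ {a b} → a ≤ b → toℚ a ℚ.≤ toℚ b
  toℚ-mono-≤ {a} {b} a≤b = ℚₚ.toℚᵘ-cancel-≤ (begin
    ℚ.toℚᵘ (toℚ a)            ≃⟨ toℚᵘ-toℚ a ⟩
    ℚᵘ.mkℚᵘ (ℤ.+ a) 0         ≤⟨ ℚᵘ.*≤* (ℤₚ.*-monoʳ-≤-nonNeg ℤ.1ℤ (ℤ.+≤+ a≤b)) ⟩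
    ℚᵘ.mkℚᵘ (ℤ.+ b) 0         ≃⟨ toℚᵘ-toℚ b ⟨
    ℚ.toℚᵘ (toℚ b)            ∎)
    where open ℚᵘₚ.≤-Reasoning

  sum-toℚ : ∀ {m} (f : Fin m → ℕ) → ℚΣ.sum {m} (toℚ ∘ f) ≡ toℚ (sum f)
  sum-toℚ {zero} f = refl
  sum-toℚ {suc m} f = trans (cong (toℚ (f zero) ℚ.+_) (sum-toℚ (f ∘ suc))) (sym (toℚ-+ (f zero) (sum (f ∘ suc))))

  halfPow*2^m≡1 : ∀ m → halfPow m ℚ.* toℚ (2 ^ m) ≡ ℚ.1ℚ
  halfPow*2^m≡1 zero = refl
  halfPow*2^m≡1 (suc m) = begin
    ℚ.½ ℚ.* halfPow m ℚ.* toℚ (2 * 2 ^ m)          ≡⟨ cong (ℚ.½ ℚ.* halfPow m ℚ.*_) (toℚ-* 2 (2 ^ m)) ⟩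
    ℚ.½ ℚ.* halfPow m ℚ.* (toℚ 2 ℚ.* toℚ (2 ^ m))  ≡⟨ regroup ℚ.½ (halfPow m) (toℚ 2) (toℚ (2 ^ m)) ⟩
    ℚ.½ ℚ.* toℚ 2 ℚ.* (halfPow m ℚ.* toℚ (2 ^ m))  ≡⟨ cong (ℚ.½ ℚ.* toℚ 2 ℚ.*_) (halfPow*2^m≡1 m) ⟩
    ℚ.1ℚ                                           ∎
    where
    open ≡-Reasoning
    open +-*-Solver
    regroup : ∀ a b c d → a ℚ.* b ℚ.* (c ℚ.* d) ≡ a ℚ.* c ℚ.* (b ℚ.* d)
    regroup = solve 4 (λ a b c d → a :* b :* (c :* d) := a :* c :* (b :* d)) refl

  Σupto-halfPow≡horner₂ : ∀ a m →
    Σupto m (λ i → halfPow i ℚ.* toℚ (a i)) ℚ.* toℚ (2 ^ m) ≡ toℚ (horner₂ a m)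
  Σupto-halfPow≡horner₂ a zero = trans (ℚₚ.*-identityʳ _) (ℚₚ.*-identityˡ _)
  Σupto-halfPow≡horner₂ a (suc m) = begin
    (A ℚ.+ H ℚ.* Y) ℚ.* toℚ (2 * 2 ^ m)           ≡⟨ cong ((A ℚ.+ H ℚ.* Y) ℚ.*_) (toℚ-* 2 (2 ^ m)) ⟩
    (A ℚ.+ H ℚ.* Y) ℚ.* (toℚ 2 ℚ.* t)             ≡⟨ distribute A H Y (toℚ 2) t ⟩
    toℚ 2 ℚ.* (A ℚ.* t) ℚ.+ H ℚ.* (toℚ 2 ℚ.* t) ℚ.* Y
      ≡⟨ cong₂ (λ p q → toℚ 2 ℚ.* p ℚ.+ q ℚ.* Y) (Σupto-halfPow≡horner₂ a m) H*2^[m+1]≡1 ⟩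
    toℚ 2 ℚ.* toℚ (horner₂ a m) ℚ.+ ℚ.1ℚ ℚ.* Y   ≡⟨ cong (toℚ 2 ℚ.* toℚ (horner₂ a m) ℚ.+_) (ℚₚ.*-identityˡ Y) ⟩
    toℚ 2 ℚ.* toℚ (horner₂ a m) ℚ.+ Y           ≡⟨ cong (ℚ._+ Y) (toℚ-* 2 (horner₂ a m)) ⟨
    toℚ (2 * horner₂ a m) ℚ.+ Y                 ≡⟨ toℚ-+ (2 * horner₂ a m) (a (suc m)) ⟨
    toℚ (horner₂ a (suc m))                     ∎
    where
    open ≡-Reasoning
    open +-*-Solver
    A H Y t : ℚ.ℚ
    A = Σupto m (λ i → halfPow i ℚ.* toℚ (a i))
    H = halfPow (suc m)
    Y = toℚ (a (suc m))
    t = toℚ (2 ^ m)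
    H*2^[m+1]≡1 : H ℚ.* (toℚ 2 ℚ.* t) ≡ ℚ.1ℚ
    H*2^[m+1]≡1 = trans (cong (H ℚ.*_) (sym (toℚ-* 2 (2 ^ m)))) (halfPow*2^m≡1 (suc m))
    distribute : ∀ a h y c t → (a ℚ.+ h ℚ.* y) ℚ.* (c ℚ.* t) ≡ c ℚ.* (a ℚ.* t) ℚ.+ h ℚ.* (c ℚ.* t) ℚ.* y
    distribute = solve 5 (λ a h y c t → (a :+ h :* y) :* (c :* t) := c :* (a :* t) :+ h :* (c :* t) :* y) refl

  module Balls (G : Graph) where

    ball-grows : ∀ v k w → T (ball G v k w) → T (ball G v (suc k) w)
    ball-grows v k w = Equivalence.from Bool.T-∨ ∘ inj₁

    ball-centre : ∀ v k → T (ball G v k v)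
    ball-centre v zero = fromWitness refl
    ball-centre v (suc k) = ball-grows v k v (ball-centre v k)

    ball-step : ∀ v k {x w} → T (ball G v k x) → T (adj G x w) → T (ball G v (suc k) w)
    ball-step v k {x} bx axw =
      Equivalence.from Bool.T-∨ (inj₂ (any⁺ _ (lose (∈-allFin x) (Equivalence.from Bool.T-∧ (bx , axw)))))

    ball-adj : ∀ {u v} → T (adj G u v) → ∀ k w → T (ball G v k w) → T (ball G u (suc k) w)
    ball-adj {u} auv zero w vw with toWitness vw
    ... | refl = ball-step u 0 (ball-centre u 0) auv
    ball-adj {u} auv (suc k) w bw with Equivalence.to Bool.T-∨ bw
    ... | inj₁ inner = ball-grows u (suc k) w (ball-adj auv k w inner)
    ... | inj₂ via-neighbour with satisfied (any⁻ _ (allFin (n G)) via-neighbour)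
    ...   | x , bx∧axw with Equivalence.to Bool.T-∧ bx∧axw
    ...     | bx , axw = ball-step u (suc k) (ball-adj auv k x bx) axw

    ball-persists : ∀ v k → ball G v (suc k) ≗ ball G v k → ball G v (suc (suc k)) ≗ ball G v (suc k)
    ball-persists v k stable w =
      cong₂ _∨_ (stable w) (cong or (map-cong (λ x → cong (_∧ adj G x w) (stable x)) (allFin (n G))))

    ball-stable : ∀ v → ball G v (suc (pred (n G))) ≗ ball G v (pred (n G))
    ball-stable v = GrowingChain.stabilises (ball G v) (ball-grows v) (ball-persists v) v (ball-centre v 0)

    -- Balls stop growing before radius n, so radius n - 1 around v already suffices.
    ball-adj-n : ∀ {u v} → T (adj G u v) → ∀ w → T (ball G v (n G) w) → T (ball G u (n G) w)
    ball-adj-n {u} {v} auv w = subst (λ k → T (ball G v k w) → T (ball G u k w)) (suc-pred (n G) {{nonZeroIndex u}})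
      (ball-adj auv (pred (n G)) w ∘ subst T (ball-stable v w))

  module Weights (G : Graph) where

    open Balls G

    -- weight m v w = 2^(m ∸ dist v w) if dist v w ≤ m, and 0 otherwise
    weight : ℕ → Fin (n G) → Fin (n G) → ℕ
    weight m v w = horner₂ (λ i → indicator (atDist G v i w)) m

    weight-vanishes : ∀ m v w → ¬ T (ball G v m w) → weight m v w ≡ 0
    weight-vanishes zero v w ∉ball = indicator-false ∉ball
    weight-vanishes (suc m) v w ∉ball = cong₂ (λ p q → 2 * p + q)
      (weight-vanishes m v w (∉ball ∘ ball-grows v m w))
      (indicator-false (∉ball ∘ proj₁ ∘ Equivalence.to Bool.T-∧))

    indicator≤weight : ∀ m v w → indicator (ball G v m w) ≤ weight m v w
    indicator≤weight zero v w = ≤-refl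
    indicator≤weight (suc m) v w = ≤-trans (indicator-≤-split (ball G v (suc m) w) (ball G v m w))
      (+-monoˡ-≤ _ (≤-trans (indicator≤weight m v w) (m≤m+n _ _)))

    2^m≤weight-centre : ∀ m w → 2 ^ m ≤ weight m w w
    2^m≤weight-centre m w = begin
      2 ^ m                                  ≡⟨ *-identityʳ (2 ^ m) ⟨
      2 ^ m * 1                              ≡⟨ cong (2 ^ m *_) (indicator-true (ball-centre w 0)) ⟨
      2 ^ m * indicator (atDist G w 0 w)     ≤⟨ 2^m*a₀≤horner₂ (λ i → indicator (atDist G w i w)) m ⟩
      weight m w w                           ∎
      where open ≤-Reasoning

    -- The correction term accounts for dist v w = m < dist u w.
    weight-adj : ∀ {u v} → T (adj G u v) → ∀ m w →
                 weight m v w ≤ 2 * weight m u w + indicator (ball G v m w ∧ not (ball G u m w))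
    weight-adj {u} {v} auv zero w = ≤-trans (indicator-≤-split (ball G v 0 w) (ball G u 0 w))
      (+-monoˡ-≤ _ (m≤m+n (indicator (ball G u 0 w)) _))
    weight-adj {u} {v} auv (suc m) w = by-cases (Bool.T? a)
      where
      a a′ c c′ : Bool
      a = ball G v m w
      a′ = ball G v (suc m) w
      c = ball G u m w
      c′ = ball G u (suc m) w
      open ≤-Reasoning
      by-cases : Dec (T a) → weight (suc m) v w ≤ 2 * weight (suc m) u w + indicator (a′ ∧ not c′)
      by-cases (yes a-holds) = begin
        2 * weight m v w + indicator (a′ ∧ not a)
          ≡⟨ cong (2 * weight m v w +_) (indicator-∧-not a′ (λ _ → a-holds)) ⟩
        2 * weight m v w + 0
          ≤⟨ +-monoˡ-≤ 0 (*-monoʳ-≤ 2 (weight-adj auv m w)) ⟩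
        2 * (2 * weight m u w + indicator (a ∧ not c)) + 0
          ≤⟨ +-mono-≤ (*-monoʳ-≤ 2 (+-monoʳ-≤ (2 * weight m u w)
               (indicator-∧-monoˡ (not c) (λ _ → ball-adj auv m w a-holds)))) z≤n ⟩
        2 * (2 * weight m u w + indicator (c′ ∧ not c)) + indicator (a′ ∧ not c′) ∎
      by-cases (no a-fails) = begin
        2 * weight m v w + indicator (a′ ∧ not a)
          ≡⟨ cong (λ p → 2 * p + indicator (a′ ∧ not a)) (weight-vanishes m v w a-fails) ⟩
        indicator (a′ ∧ not a)
          ≤⟨ indicator-mono (proj₁ ∘ Equivalence.to Bool.T-∧) ⟩
        indicator a′
          ≤⟨ indicator-≤-split a′ c′ ⟩
        indicator c′ + indicator (a′ ∧ not c′)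
          ≤⟨ +-monoˡ-≤ _ (≤-trans (indicator≤weight (suc m) u w) (m≤m+n _ _)) ⟩
        2 * weight (suc m) u w + indicator (a′ ∧ not c′) ∎

    weight-halves-along-edges : ∀ {u v} → T (adj G u v) → ∀ w → weight (n G) v w ≤ 2 * weight (n G) u w
    weight-halves-along-edges {u} {v} auv w = begin
      weight (n G) v w                                             ≤⟨ weight-adj auv (n G) w ⟩
      2 * weight (n G) u w + indicator (ball G v (n G) w ∧ not (ball G u (n G) w))
        ≡⟨ cong (2 * weight (n G) u w +_) (indicator-∧-not _ (ball-adj-n auv w)) ⟩
      2 * weight (n G) u w + 0                                     ≡⟨ +-identityʳ _ ⟩
      2 * weight (n G) u w                                         ∎
      where open ≤-Reasoning

  module Potential (G : Graph) where

    potential : (Fin (n G) → ℕ) → Dist G → ℕ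
    potential c Q = ∑[ x < n G ] (c x * Q x)

    potential-+ : ∀ c (Q R : Dist G) → potential c (λ x → Q x + R x) ≡ potential c Q + potential c R
    potential-+ c Q R = trans (sum-cong-≗ (λ x → *-distribˡ-+ (c x) (Q x) (R x))) (∑-distrib-+ (λ x → c x * Q x) (λ x → c x * R x))

    potential-*ˡ : ∀ c k (Q : Dist G) → potential c (λ x → k * Q x) ≡ k * potential c Q
    potential-*ˡ c k Q = trans (sum-cong-≗ (λ x → ℕ*.x∙yz≈y∙xz (c x) k (Q x))) (sym (*-distribˡ-sum k (λ x → c x * Q x)))

    move+2δ≡+δ : ∀ {Q : Dist G} {u v} → u ≢ v → 2 ≤ Q u → ∀ x → move G Q u v x + 2 * δ u x ≡ Q x + δ v x
    move+2δ≡+δ {Q} {u} {v} u≢v 2≤Qu x with x ≟ u | x ≟ v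
    ... | yes refl | yes refl = ⊥-elim (u≢v refl)
    ... | yes refl | no _ = trans (cong (_+ 2) (+-identityʳ (Q x ∸ 2))) (trans (m∸n+n≡m 2≤Qu) (sym (+-identityʳ (Q x))))
    ... | no _ | yes refl = +-identityʳ (Q x + 1)
    ... | no _ | no _ = +-identityʳ (Q x + 0)

    potential-move : ∀ c {Q : Dist G} {u v} → c v ≤ 2 * c u → u ≢ v → 2 ≤ Q u →
                     potential c (move G Q u v) ≤ potential c Q
    potential-move c {Q} {u} {v} cv≤2cu u≢v 2≤Qu = +-cancelʳ-≤ (2 * c u) _ _ (begin
      potential c (move G Q u v) + 2 * c u
        ≡⟨ cong (potential c (move G Q u v) +_) (trans (potential-*ˡ c 2 (δ u)) (cong (2 *_) (∑-*-δ c u))) ⟨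
      potential c (move G Q u v) + potential c (λ x → 2 * δ u x)
        ≡⟨ potential-+ c (move G Q u v) (λ x → 2 * δ u x) ⟨
      potential c (λ x → move G Q u v x + 2 * δ u x)
        ≡⟨ sum-cong-≗ (λ x → cong (c x *_) (move+2δ≡+δ u≢v 2≤Qu x)) ⟩
      potential c (λ x → Q x + δ v x)
        ≡⟨ potential-+ c Q (δ v) ⟩
      potential c Q + potential c (δ v)
        ≡⟨ cong (potential c Q +_) (∑-*-δ c v) ⟩
      potential c Q + c v
        ≤⟨ +-monoʳ-≤ (potential c Q) cv≤2cu ⟩
      potential c Q + 2 * c u ∎)
      where open ≤-Reasoning

    potential-Moves : ∀ c → (∀ {u v} → T (adj G u v) → c v ≤ 2 * c u) →
                      ∀ {P Q} → Moves G P Q → potential c Q ≤ potential c P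
    potential-Moves c halves done = ≤-refl
    potential-Moves c halves (step u v auv 2≤Pu moves) =
      ≤-trans (potential-Moves c halves moves) (potential-move c (halves (Equivalence.from Bool.T-≡ auv)) u≢v 2≤Pu)
      where
      u≢v : u ≢ v
      u≢v refl = contradiction (trans (sym auv) (irrefl G u)) λ ()

  module Effect (G : Graph) where

    open Weights G
    open Potential G

    scaledEffect : Fin (n G) → ℕ
    scaledEffect v = horner₂ (Nsize G v) (n G)

    ef*2^n≡scaledEffect : ∀ v → ef G v ℚ.* toℚ (2 ^ n G) ≡ toℚ (scaledEffect v)
    ef*2^n≡scaledEffect v = Σupto-halfPow≡horner₂ (Nsize G v) (n G)

    ∑-weight≡scaledEffect : ∀ v → ∑[ w < n G ] weight (n G) v w ≡ scaledEffect v
    ∑-weight≡scaledEffect v = trans (∑-horner₂ (λ w i → indicator (atDist G v i w)) (n G))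
      (horner₂-cong (λ i → sym (Σℕ≡sum (λ w → indicator (atDist G v i w)))) (n G))

    reach-bound : ∀ {P k w} → KReachable G P k w → 2 ^ n G * k ≤ potential (λ x → weight (n G) x w) P
    reach-bound {P} {k} {w} (Q , moves , k≤Qw) = begin
      2 ^ n G * k                            ≤⟨ *-mono-≤ (2^m≤weight-centre (n G) w) k≤Qw ⟩
      weight (n G) w w * Q w                 ≤⟨ ≤-sum (λ x → weight (n G) x w * Q x) w ⟩
      potential (λ x → weight (n G) x w) Q   ≤⟨ potential-Moves _ (λ auv → weight-halves-along-edges auv w) moves ⟩
      potential (λ x → weight (n G) x w) P   ∎
      where open ≤-Reasoning

    ∑-reach-bound : ∀ {P r} → IsReach G P r → 2 ^ n G * sum r ≤ ∑[ v < n G ] (scaledEffect v * P v)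
    ∑-reach-bound {P} {r} isReach = begin
      2 ^ n G * sum r                                     ≡⟨ *-distribˡ-sum (2 ^ n G) r ⟩
      ∑[ w < n G ] (2 ^ n G * r w)                        ≤⟨ sum-mono-≤ (λ w → reach-bound (proj₁ (isReach w))) ⟩
      ∑[ w < n G ] potential (λ x → weight (n G) x w) P   ≡⟨ ∑-comm (λ w x → weight (n G) x w * P x) ⟩
      ∑[ x < n G ] ∑[ w < n G ] (weight (n G) x w * P x)
        ≡⟨ sum-cong-≗ (λ x → *-distribʳ-sum (P x) (λ w → weight (n G) x w)) ⟨
      ∑[ x < n G ] (∑[ w < n G ] weight (n G) x w * P x)
        ≡⟨ sum-cong-≗ (λ x → cong (_* P x) (∑-weight≡scaledEffect x)) ⟩
      ∑[ x < n G ] (scaledEffect x * P x)                 ∎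
      where open ≤-Reasoning

    n+TE≡∑reach : ∀ {P r} → Solvable G P → IsReach G P r → n G + TE G r ≡ sum r
    n+TE≡∑reach {P} {r} solvable isReach = begin
      n G + TE G r                               ≡⟨ cong₂ _+_ (sym (∑-1 (n G))) (Σℕ≡sum (λ v → r v ∸ 1)) ⟩
      ∑[ v < n G ] 1 + ∑[ v < n G ] (r v ∸ 1)    ≡⟨ ∑-distrib-+ (λ _ → 1) (λ v → r v ∸ 1) ⟨
      ∑[ v < n G ] (1 + (r v ∸ 1))               ≡⟨ sum-cong-≗ (λ v → m+[n∸m]≡n (1≤reach v)) ⟩
      sum r                                      ∎
      where
      open ≡-Reasoning
      1≤reach : ∀ v → 1 ≤ r v
      1≤reach v with r v | proj₂ (isReach v)
      ... | zero | unreachable = contradiction (solvable v) unreachable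
      ... | suc _ | _ = s≤s z≤n

    Σℚ-ef*P*2^n : ∀ (P : Dist G) →
      Σℚ (λ v → ef G v ℚ.* toℚ (P v)) ℚ.* toℚ (2 ^ n G) ≡ toℚ (∑[ v < n G ] (scaledEffect v * P v))
    Σℚ-ef*P*2^n P = begin
      Σℚ f ℚ.* t                                  ≡⟨ cong (ℚ._* t) (Σℚ≡sum f) ⟩
      ℚΣ.sum f ℚ.* t                              ≡⟨ ℚΣ.*-distribʳ-sum t f ⟩
      ℚΣ.sum (λ v → f v ℚ.* t)                    ≡⟨ ℚΣ.sum-cong-≗ pointwise ⟩
      ℚΣ.sum (λ v → toℚ (scaledEffect v * P v))   ≡⟨ sum-toℚ (λ v → scaledEffect v * P v) ⟩
      toℚ (∑[ v < n G ] (scaledEffect v * P v))   ∎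
      where
      open ≡-Reasoning
      t : ℚ.ℚ
      t = toℚ (2 ^ n G)
      f : Fin (n G) → ℚ.ℚ
      f v = ef G v ℚ.* toℚ (P v)
      pointwise : ∀ v → f v ℚ.* t ≡ toℚ (scaledEffect v * P v)
      pointwise v = begin
        ef G v ℚ.* toℚ (P v) ℚ.* t              ≡⟨ ℚ*.xy∙z≈xz∙y (ef G v) (toℚ (P v)) t ⟩
        ef G v ℚ.* t ℚ.* toℚ (P v)              ≡⟨ cong (ℚ._* toℚ (P v)) (ef*2^n≡scaledEffect v) ⟩
        toℚ (scaledEffect v) ℚ.* toℚ (P v)      ≡⟨ toℚ-* (scaledEffect v) (P v) ⟨
        toℚ (scaledEffect v * P v)              ∎

open EffectBound using (toℚ-*; toℚ-mono-≤)
open EffectBound.Effect using (scaledEffect; n+TE≡∑reach; ∑-reach-bound; Σℚ-ef*P*2^n)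
open import Data.Fin using (Fin)
open import Data.Nat using (ℕ; _+_)
open import Data.Rational using (_≤_; _*_; Positive)
import Data.Nat as ℕ
import Data.Nat.Properties as ℕₚ
open import Algebra.Properties.Semiring.Sum ℕₚ.+-*-semiring using (sum; sum-syntax)
import Data.Rational.Properties as ℚₚ
open import Relation.Binary.PropositionalEquality using (cong)

theorem2p1 : (G : Graph) (P : Dist G) → Solvable G P →
    (r : Fin (n G) → ℕ) → IsReach G P r →
    toℚ (n G + TE G r) ≤ Σℚ (λ v → ef G v * toℚ (P v))
theorem2p1 G P solvable r isReach = ℚₚ.*-cancelʳ-≤-pos (toℚ 2^n) {{2^n-positive}} (begin
  toℚ (n G + TE G r) * toℚ 2^n                    ≡⟨ toℚ-* (n G + TE G r) 2^n ⟨
  toℚ ((n G + TE G r) ℕ.* 2^n)                    ≡⟨ cong (λ k → toℚ (k ℕ.* 2^n)) (n+TE≡∑reach G solvable isReach) ⟩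
  toℚ (sum r ℕ.* 2^n)                             ≡⟨ cong toℚ (ℕₚ.*-comm (sum r) 2^n) ⟩
  toℚ (2^n ℕ.* sum r)                             ≤⟨ toℚ-mono-≤ (∑-reach-bound G isReach) ⟩
  toℚ (∑[ v < n G ] (scaledEffect G v ℕ.* P v))   ≡⟨ Σℚ-ef*P*2^n G P ⟨
  Σℚ (λ v → ef G v * toℚ (P v)) * toℚ 2^n         ∎)
  where
  open ℚₚ.≤-Reasoning
  2^n : ℕ
  2^n = 2 ℕ.^ n G
  2^n-positive : Positive (toℚ 2^n)
  2^n-positive = ℚₚ.normalize-pos 2^n 1 {{_}} {{ℕₚ.m^n≢0 2 (n G)}}
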